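{- Let $\Psi\in\{\mathfrak F,\mathfrak B\}$, let $\alpha,\beta$ satisfy $2<\alpha\le 3$ and $4\alpha-\beta=6$, and let $G\in\mathcal G(\Psi,\alpha,\beta)$. Then $|G|\ge 6$.
   Context: All graphs are finite and simple. $|G|$ is the number of vertices, $e(G)$ the number of edges, $G|_X$ the subgraph induced on $X$. $q_{\alpha,\beta}(G)=\alpha|G|-e(G)-\beta$. $\mathfrak F$ is the class of forests and $\mathfrak B$ the class of bipartite graphs. A vertex cut is a vertex set whose removal disconnects the graph; a $\Psi$-cut of $G$ is a vertex cut $M$ with $G|_M\in\Psi$. $\mathcal G(\Psi,\alpha,\beta)$ is the set of graphs $G$ such that $|G|\ge4$, $q_{\alpha,\beta}(G)>0$, $G$ has no $\Psi$-cut, and $G$ has the smallest number of vertices among all graphs with these three properties.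
   Formalization: The parameters α and β are rational numbers rather than real ones. -}

module Defs where

open import Data.Nat as ℕ using (ℕ; _<ᵇ_)
open import Data.Bool using (Bool; true; false; _∧_; if_then_else_)
open import Data.Fin using (Fin; toℕ)
open import Data.Fin.Subset using (Subset; _∈_; _∉_)
open import Data.List using (List; []; _∷_; length; map; allFin; _++_)
open import Data.Nat.ListAction using (sum)
open import Data.Unit using (⊤)
open import Data.List.Relation.Unary.All using (All)
open import Data.List.Relation.Unary.Unique.Propositional using (Unique)
open import Data.Integer using (+_)
open import Data.Rational using (ℚ; _/_; _*_; _-_; _<_; 0ℚ)
open import Data.Product using (Σ; ∃; _×_)
open import Relation.Binary.PropositionalEquality using (_≡_)
open import Relation.Nullary using (¬_)

record Graph (n : ℕ) : Set where
  field
    adj    : Fin n → Fin n → Bool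
    sym    : ∀ i j → adj i j ≡ adj j i
    irrefl : ∀ i → adj i i ≡ false
open Graph public

∣_∣ᵥ : ∀ {n} → Graph n → ℕ
∣_∣ᵥ {n} _ = n

e : ∀ {n} → Graph n → ℕ
e {n} G = sum (map (λ i → sum (map (λ j →
            if (adj G i j ∧ (toℕ i <ᵇ toℕ j)) then 1 else 0) (allFin n))) (allFin n))

ℕ→ℚ : ℕ → ℚ
ℕ→ℚ k = (+ k) / 1

q : ℚ → ℚ → ∀ {n} → Graph n → ℚ
q α β {n} G = ((α * ℕ→ℚ n) - ℕ→ℚ (e G)) - β

Consecutive : ∀ {n} → Graph n → List (Fin n) → Set
Consecutive G []            = ⊤
Consecutive G (x ∷ [])      = ⊤
Consecutive G (x ∷ y ∷ xs)  = (adj G x y ≡ true) × Consecutive G (y ∷ xs)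

record CycleIn {n} (G : Graph n) (M : Subset n) : Set where
  field
    first  : Fin n
    rest   : List (Fin n)
    last   : Fin n
    long   : 3 ℕ.≤ length (first ∷ rest ++ (last ∷ []))
    unique : Unique (first ∷ rest ++ (last ∷ []))
    inM    : All (_∈ M) (first ∷ rest ++ (last ∷ []))
    path   : Consecutive G (first ∷ rest ++ (last ∷ []))
    close  : adj G last first ≡ true

InducedForest : ∀ {n} → Graph n → Subset n → Set
InducedForest G M = ¬ CycleIn G M

InducedBipartite : ∀ {n} → Graph n → Subset n → Set
InducedBipartite {n} G M =
  Σ (Fin n → Bool) λ c → ∀ i j → i ∈ M → j ∈ M → adj G i j ≡ true → ¬ (c i ≡ c j)

data Class : Set where
  𝔉 𝔅 : Class

InducedIn : Class → ∀ {n} → Graph n → Subset n → Set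
InducedIn 𝔉 G M = InducedForest G M
InducedIn 𝔅 G M = InducedBipartite G M

-- Reachability in G - M (walks using only vertices outside M after the start)
data ReachAvoid {n} (G : Graph n) (M : Subset n) : Fin n → Fin n → Set where
  here : ∀ {u} → ReachAvoid G M u u
  step : ∀ {u v w} → adj G u v ≡ true → v ∉ M → ReachAvoid G M v w → ReachAvoid G M u w

VertexCut : ∀ {n} → Graph n → Subset n → Set
VertexCut G M = ∃ λ u → ∃ λ v → u ∉ M × v ∉ M × ¬ ReachAvoid G M u v

ΨCut : Class → ∀ {n} → Graph n → Subset n → Set
ΨCut Ψ G M = VertexCut G M × InducedIn Ψ G M

Admissible : Class → ℚ → ℚ → ∀ {n} → Graph n → Set
Admissible Ψ α β {n} G = (4 ℕ.≤ n) × (0ℚ < q α β G) × (∀ M → ¬ ΨCut Ψ G M)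

InClassG : Class → ℚ → ℚ → ∀ {n} → Graph n → Set
InClassG Ψ α β {n} G =
  Admissible Ψ α β G × (∀ m (H : Graph m) → Admissible Ψ α β H → n ℕ.≤ m)

-- A graph on four vertices with a non-edge uv has the Ψ-cut V ∖ {u, v}; one on five vertices
-- with two non-edges has one too: V ∖ {u, v, w} if they are uv and uw, V ∖ {u, v} if they are
-- uv and xy. In each case u is isolated in what remains, and the cut spans a triangle-free graph
-- on at most three vertices, which is both a forest and bipartite. Hence a graph of 𝒢(Ψ, α, β)
-- on n ∈ {4, 5} vertices has at least 6, resp. 9 edges, whereas q > 0 and 4α − β = 6 give
-- e(G) < (n − 4)α + 6 ≤ 6, resp. 9.
module Submission where

open import Defs
open import Data.Bool using (Bool; true; false; _∧_; if_then_else_)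
import Data.Bool as Bool
open import Data.Bool.Properties using (T-≡)
open import Data.Empty using (⊥; ⊥-elim)
open import Data.Fin using (Fin; zero; toℕ; _≟_)
open import Data.Fin.Properties using (any?; all?)
open import Data.Fin.Subset using (Subset; _∈_; ∁; ⁅_⁆; _∪_; ∣_∣)
open import Data.Fin.Subset.Properties
  using (_∈?_; x∈p⇒∣p-x∣<∣p∣; x∈p∧x≢y⇒x∈p-y; ∣∁p∣≡n∸∣p∣; x∈p⇒x∉∁p; x∉∁p⇒x∈p; x∉p⇒x∈∁p;
         x∈p∪q⁺; x∈p∪q⁻; x∈⁅x⁆; x∈⁅y⁆⇒x≡y; x≢y⇒x∉⁅y⁆)
open import Data.List using (List; []; _∷_; length; map; allFin)
open import Data.List.Properties using (length-++)
open import Data.List.Membership.Propositional using () renaming (_∈_ to _∈ˡ_)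
import Data.List.Membership.DecPropositional as DecMembership
open import Data.List.Relation.Unary.All as All using (All; []; _∷_)
open import Data.List.Relation.Unary.All.Properties using (¬Any⇒All¬)
open import Data.List.Relation.Unary.Any using (here; there)
open import Data.List.Relation.Unary.AllPairs using ([]; _∷_)
open import Data.List.Relation.Unary.Unique.Propositional using (Unique)
open import Data.Nat using (ℕ; suc; z≤n; s≤s; _≤_; _<_; _≤?_; _∸_; _<ᵇ_)
open import Data.Nat.Coprimality using (1-coprimeTo) renaming (sym to coprime-sym)
open import Data.Nat.ListAction using (sum)
open import Data.Nat.Properties
  using (≤-trans; ≤-refl; n≮n; <⇒≱; m≤n⇒m≤1+n; m≤n+m; m≤m+n; ∸-monoʳ-≤; +-mono-≤)
open import Data.Integer using (+_)
import Data.Integer.Properties as ℤ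
open import Data.Rational using (ℚ; 0ℚ; _+_; _*_; _-_; _/_)
import Data.Rational as ℚ
open import Data.Rational.Properties
  using (normalize-coprime; drop-*<*; +-monoˡ-<; +-monoˡ-≤; +-identityˡ; *-comm; <-≤-trans)
open import Data.Rational.Solver using (module +-*-Solver)
open import Data.Product using (_×_; _,_)
open import Data.Sum using (_⊎_; inj₁; inj₂; [_,_])
open import Function using (_∘_)
open import Function.Bundles using (Equivalence)
open import Relation.Binary.PropositionalEquality as ≡
  using (_≡_; refl; _≢_; ≢-sym; trans; cong; subst₂)
open import Relation.Nullary using (¬_; yes; no)
open import Relation.Nullary.Decidable using (⌊_⌋; toWitness; ¬?; _⊎-dec_; _×-dec_)
open +-*-Solver using (solve; _:+_; _:*_; _:-_; con; _:=_)

private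
  variable
    n : ℕ

distinct⇒length≤∣∣ : {p : Subset n} {xs : List (Fin n)} →
                      Unique xs → All (_∈ p) xs → length xs ≤ ∣ p ∣
distinct⇒length≤∣∣ [] [] = z≤n
distinct⇒length≤∣∣ (x∉xs ∷ xs!) (x∈p ∷ xs⊆p) =
  ≤-trans (s≤s (distinct⇒length≤∣∣ xs! xs⊆p-x)) (x∈p⇒∣p-x∣<∣p∣ x∈p)
  where
  xs⊆p-x = All.zipWith (λ (y∈p , x≢y) → x∈p∧x≢y⇒x∈p-y y∈p (≢-sym x≢y)) (xs⊆p , x∉xs)

distinct⇒enumerates : {p : Subset n} {xs : List (Fin n)} → ∣ p ∣ ≤ length xs →
                      Unique xs → All (_∈ p) xs → ∀ {x} → x ∈ p → x ∈ˡ xs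
distinct⇒enumerates {xs = xs} ∣p∣≤ xs! xs⊆p {x} x∈p with DecMembership._∈?_ _≟_ x xs
... | yes x∈xs = x∈xs
... | no  x∉xs =
  ⊥-elim (n≮n _ (≤-trans (distinct⇒length≤∣∣ (¬Any⇒All¬ xs x∉xs ∷ xs!) (x∈p ∷ xs⊆p)) ∣p∣≤))

distinct⇒∣∁p∣≤n∸length : {p : Subset n} {xs : List (Fin n)} →
                          Unique xs → All (_∈ p) xs → ∣ ∁ p ∣ ≤ n ∸ length xs
distinct⇒∣∁p∣≤n∸length {n} {p} {xs} xs! xs⊆p =
  ≡.subst (_≤ n ∸ length xs) (≡.sym (∣∁p∣≡n∸∣p∣ p)) (∸-monoʳ-≤ n (distinct⇒length≤∣∣ xs! xs⊆p))

x∈⁅x⁆∪p : (x : Fin n) (p : Subset n) → x ∈ ⁅ x ⁆ ∪ p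
x∈⁅x⁆∪p x p = x∈p∪q⁺ (inj₁ (x∈⁅x⁆ x))

∣∁⁅x⁆∪⁅y⁆∣≤n∸2 : {x y : Fin n} → x ≢ y → ∣ ∁ (⁅ x ⁆ ∪ ⁅ y ⁆) ∣ ≤ n ∸ 2
∣∁⁅x⁆∪⁅y⁆∣≤n∸2 {x = x} {y} x≢y =
  distinct⇒∣∁p∣≤n∸length ((x≢y ∷ []) ∷ [] ∷ []) (x∈⁅x⁆∪p x ⁅ y ⁆ ∷ x∈p∪q⁺ (inj₂ (x∈⁅x⁆ y)) ∷ [])

≡true⇒≢false : {b : Bool} → b ≡ true → b ≢ false
≡true⇒≢false refl ()

adj⇒≢ : (G : Graph n) {i j : Fin n} → adj G i j ≡ true → i ≢ j
adj⇒≢ G {i} ij refl = ≡true⇒≢false ij (irrefl G i)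

adj-sym : (G : Graph n) {i j : Fin n} {b : Bool} → adj G i j ≡ b → adj G j i ≡ b
adj-sym G {i} {j} ij = trans (sym G j i) ij

record TriangleIn (G : Graph n) (M : Subset n) : Set where
  constructor triangle
  field
    {a b c}  : Fin n
    a∈M      : a ∈ M
    b∈M      : b ∈ M
    c∈M      : c ∈ M
    ab       : adj G a b ≡ true
    bc       : adj G b c ≡ true
    ca       : adj G c a ≡ true

module _ {G : Graph n} {M : Subset n} (t : TriangleIn G M) where
  open TriangleIn t

  triangle-distinct : Unique (a ∷ b ∷ c ∷ [])
  triangle-distinct =
    (adj⇒≢ G ab ∷ adj⇒≢ G (adj-sym G ca) ∷ []) ∷ (adj⇒≢ G bc ∷ []) ∷ [] ∷ []

  triangle-⊆ : All (_∈ M) (a ∷ b ∷ c ∷ [])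
  triangle-⊆ = a∈M ∷ b∈M ∷ c∈M ∷ []

  triangle-adj : ∀ {x y} → x ∈ˡ (a ∷ b ∷ c ∷ []) → y ∈ˡ (a ∷ b ∷ c ∷ []) → x ≢ y → adj G x y ≡ true
  triangle-adj (here refl)                 (here refl)                 x≢y = ⊥-elim (x≢y refl)
  triangle-adj (here refl)                 (there (here refl))         _   = ab
  triangle-adj (here refl)                 (there (there (here refl))) _   = adj-sym G ca
  triangle-adj (there (here refl))         (here refl)                 _   = adj-sym G ab
  triangle-adj (there (here refl))         (there (here refl))         x≢y = ⊥-elim (x≢y refl)
  triangle-adj (there (here refl))         (there (there (here refl))) _   = bc
  triangle-adj (there (there (here refl))) (here refl)                 _   = ca
  triangle-adj (there (there (here refl))) (there (here refl))         _   = adj-sym G bc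
  triangle-adj (there (there (here refl))) (there (there (here refl))) x≢y = ⊥-elim (x≢y refl)

nonEdge⇒triangleFree : {G : Graph n} {M : Subset n} {x y : Fin n} → ∣ M ∣ ≤ 3 →
                       x ∈ M → y ∈ M → x ≢ y → adj G x y ≡ false → ¬ TriangleIn G M
nonEdge⇒triangleFree ∣M∣≤3 x∈M y∈M x≢y xy t =
  ≡true⇒≢false (triangle-adj t (enumerate x∈M) (enumerate y∈M) x≢y) xy
  where enumerate = distinct⇒enumerates ∣M∣≤3 (triangle-distinct t) (triangle-⊆ t)

cycle⇒triangle : {G : Graph n} {M : Subset n} → ∣ M ∣ ≤ 3 → CycleIn G M → TriangleIn G M
cycle⇒triangle _ record { rest = [] ; long = s≤s (s≤s ()) }
cycle⇒triangle _
  record { rest = _ ∷ [] ; inM = a∈M ∷ b∈M ∷ c∈M ∷ [] ; path = ab , bc , _ ; close = ca } =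
  triangle a∈M b∈M c∈M ab bc ca
cycle⇒triangle ∣M∣≤3 record { rest = _ ∷ _ ∷ rs ; last = l ; unique = distinct ; inM = inM } =
  ⊥-elim (n≮n 3 (≤-trans (s≤s (s≤s (s≤s (≡.subst (1 ≤_) (≡.sym (length-++ rs)) (m≤n+m 1 _)))))
                 (≤-trans (distinct⇒length≤∣∣ distinct inM) ∣M∣≤3)))

triangleFree⇒bipartite : {G : Graph n} {M : Subset n} → ∣ M ∣ ≤ 3 → ¬ TriangleIn G M →
                         InducedBipartite G M
triangleFree⇒bipartite {G = G} {M} ∣M∣≤3 noTriangle
  with any? (λ a → a ∈? M ×-dec any? (λ b → b ∈? M ×-dec adj G a b Bool.≟ true))
... | no noEdge = (λ _ → true) , λ i j i∈M j∈M ij _ → noEdge (i , i∈M , j , j∈M , ij)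
... | yes (a , a∈M , b , b∈M , ab) = adj G a , proper
  where
  -- No edge joins two neighbours of a (no triangle), nor two non-neighbours of a (b would be a
  -- fourth vertex).
  proper : ∀ i j → i ∈ M → j ∈ M → adj G i j ≡ true → ¬ (adj G a i ≡ adj G a j)
  proper i j i∈M j∈M ij same with i ≟ a | j ≟ a
  ... | yes refl | _ = ≡true⇒≢false (trans same ij) (irrefl G a)
  ... | _ | yes refl = ≡true⇒≢false (trans (≡.sym same) (adj-sym G ij)) (irrefl G a)
  ... | no i≢a | no j≢a with adj G a i in ai
  ...   | true  = noTriangle (triangle a∈M i∈M j∈M ai ij (adj-sym G (≡.sym same)))
  ...   | false with distinct⇒enumerates ∣M∣≤3 aij! (a∈M ∷ i∈M ∷ j∈M ∷ []) b∈M
    where aij! = (≢-sym i≢a ∷ ≢-sym j≢a ∷ []) ∷ (adj⇒≢ G ij ∷ []) ∷ [] ∷ []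
  ...     | here refl                 = ≡true⇒≢false ab (irrefl G a)
  ...     | there (here refl)         = ≡true⇒≢false ab ai
  ...     | there (there (here refl)) = ≡true⇒≢false ab (≡.sym same)

triangleFree⇒InducedIn : (Ψ : Class) {G : Graph n} {M : Subset n} → ∣ M ∣ ≤ 3 → ¬ TriangleIn G M →
                         InducedIn Ψ G M
triangleFree⇒InducedIn 𝔉 ∣M∣≤3 noTriangle = noTriangle ∘ cycle⇒triangle ∣M∣≤3
triangleFree⇒InducedIn 𝔅 ∣M∣≤3 noTriangle = triangleFree⇒bipartite ∣M∣≤3 noTriangle

∣∣≤2⇒InducedIn : (Ψ : Class) {G : Graph n} {M : Subset n} → ∣ M ∣ ≤ 2 → InducedIn Ψ G M
∣∣≤2⇒InducedIn Ψ ∣M∣≤2 = triangleFree⇒InducedIn Ψ (m≤n⇒m≤1+n ∣M∣≤2) λ t →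
  n≮n 2 (≤-trans (distinct⇒length≤∣∣ (triangle-distinct t) (triangle-⊆ t)) ∣M∣≤2)

∈⁅⁆⇒nonNeighbour : (G : Graph n) {u v : Fin n} → adj G u v ≡ false →
                   ∀ {w} → w ∈ ⁅ v ⁆ → adj G u w ≡ false
∈⁅⁆⇒nonNeighbour G {v = v} uv w∈⁅v⁆ rewrite x∈⁅y⁆⇒x≡y v w∈⁅v⁆ = uv

nonNeighbours⇒VertexCut : (G : Graph n) {N : Subset n} {u v : Fin n} → v ∈ N → u ≢ v →
                          (∀ {w} → w ∈ N → adj G u w ≡ false) → VertexCut G (∁ (⁅ u ⁆ ∪ N))
nonNeighbours⇒VertexCut G {N} {u} {v} v∈N u≢v nonNeighbour =
  u , v , x∈p⇒x∉∁p (x∈⁅x⁆∪p u N) , x∈p⇒x∉∁p (x∈p∪q⁺ (inj₂ v∈N)) , unreachable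
  where
  isolated : ∀ {w} → w ∈ ⁅ u ⁆ ∪ N → adj G u w ≡ false
  isolated w∈S with x∈p∪q⁻ ⁅ u ⁆ N w∈S
  ... | inj₁ w∈⁅u⁆ rewrite x∈⁅y⁆⇒x≡y u w∈⁅u⁆ = irrefl G u
  ... | inj₂ w∈N = nonNeighbour w∈N

  unreachable : ¬ ReachAvoid G (∁ (⁅ u ⁆ ∪ N)) u v
  unreachable here             = u≢v refl
  unreachable (step uw w∉∁S _) = ≡true⇒≢false uw (isolated (x∉∁p⇒x∈p w∉∁S))

nonEdge⇒ΨCut₄ : (Ψ : Class) (G : Graph 4) {u v : Fin 4} → u ≢ v → adj G u v ≡ false →
                ΨCut Ψ G (∁ (⁅ u ⁆ ∪ ⁅ v ⁆))
nonEdge⇒ΨCut₄ Ψ G {u} {v} u≢v uv =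
  nonNeighbours⇒VertexCut G (x∈⁅x⁆ v) u≢v (∈⁅⁆⇒nonNeighbour G uv) ,
  ∣∣≤2⇒InducedIn Ψ (∣∁⁅x⁆∪⁅y⁆∣≤n∸2 u≢v)

disjointNonEdges⇒ΨCut₅ : (Ψ : Class) (G : Graph 5) {u v x y : Fin 5} → u ≢ v → x ≢ y →
                         x ≢ u → x ≢ v → y ≢ u → y ≢ v → adj G u v ≡ false → adj G x y ≡ false →
                         ΨCut Ψ G (∁ (⁅ u ⁆ ∪ ⁅ v ⁆))
disjointNonEdges⇒ΨCut₅ Ψ G {u} {v} u≢v x≢y x≢u x≢v y≢u y≢v uv xy =
  nonNeighbours⇒VertexCut G (x∈⁅x⁆ v) u≢v (∈⁅⁆⇒nonNeighbour G uv) ,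
  triangleFree⇒InducedIn Ψ ∣M∣≤3
    (nonEdge⇒triangleFree ∣M∣≤3 (outside x≢u x≢v) (outside y≢u y≢v) x≢y xy)
  where
  outside : ∀ {z} → z ≢ u → z ≢ v → z ∈ ∁ (⁅ u ⁆ ∪ ⁅ v ⁆)
  outside z≢u z≢v = x∉p⇒x∈∁p ([ x≢y⇒x∉⁅y⁆ z≢u , x≢y⇒x∉⁅y⁆ z≢v ] ∘ x∈p∪q⁻ ⁅ u ⁆ ⁅ v ⁆)
  ∣M∣≤3 = ∣∁⁅x⁆∪⁅y⁆∣≤n∸2 u≢v

sharedNonEdges⇒ΨCut₅ : (Ψ : Class) (G : Graph 5) {u v w : Fin 5} → u ≢ v → u ≢ w → v ≢ w →
                       adj G u v ≡ false → adj G u w ≡ false → ΨCut Ψ G (∁ (⁅ u ⁆ ∪ ⁅ v ⁆ ∪ ⁅ w ⁆))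
sharedNonEdges⇒ΨCut₅ Ψ G {u} {v} {w} u≢v u≢w v≢w uv uw =
  nonNeighbours⇒VertexCut G v∈N u≢v nonNeighbour ,
  ∣∣≤2⇒InducedIn Ψ ∣M∣≤2
  where
  v∈N = x∈⁅x⁆∪p v ⁅ w ⁆
  w∈N = x∈p∪q⁺ (inj₂ (x∈⁅x⁆ w))
  nonNeighbour : ∀ {z} → z ∈ ⁅ v ⁆ ∪ ⁅ w ⁆ → adj G u z ≡ false
  nonNeighbour z∈N with x∈p∪q⁻ ⁅ v ⁆ ⁅ w ⁆ z∈N
  ... | inj₁ z∈⁅v⁆ = ∈⁅⁆⇒nonNeighbour G uv z∈⁅v⁆
  ... | inj₂ z∈⁅w⁆ = ∈⁅⁆⇒nonNeighbour G uw z∈⁅w⁆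
  ∣M∣≤2 = distinct⇒∣∁p∣≤n∸length ((u≢v ∷ u≢w ∷ []) ∷ (v≢w ∷ []) ∷ [] ∷ [])
                                   (x∈⁅x⁆∪p u _ ∷ x∈p∪q⁺ (inj₂ v∈N) ∷ x∈p∪q⁺ (inj₂ w∈N) ∷ [])

noΨCut⇒complete₄ : (Ψ : Class) (G : Graph 4) → (∀ M → ¬ ΨCut Ψ G M) →
                   ∀ {i j} → i ≢ j → adj G i j ≡ true
noΨCut⇒complete₄ Ψ G noCut {i} {j} i≢j with adj G i j in ij
... | true  = refl
... | false = ⊥-elim (noCut _ (nonEdge⇒ΨCut₄ Ψ G i≢j ij))

noΨCut⇒uniqueNonEdge₅ : (Ψ : Class) (G : Graph 5) → (∀ M → ¬ ΨCut Ψ G M) →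
                        ∀ {u v x y} → u ≢ v → adj G u v ≡ false → x ≢ y → adj G x y ≡ false →
                        (x ≡ u × y ≡ v) ⊎ (x ≡ v × y ≡ u)
noΨCut⇒uniqueNonEdge₅ Ψ G noCut {u} {v} {x} {y} u≢v uv x≢y xy
  with x ≟ u | y ≟ v | x ≟ v | y ≟ u
... | yes refl | yes refl | _        | _        = inj₁ (refl , refl)
... | yes refl | no y≢v   | _        | _        =
  ⊥-elim (noCut _ (sharedNonEdges⇒ΨCut₅ Ψ G u≢v x≢y (≢-sym y≢v) uv xy))
... | no x≢u   | yes refl | _        | _        =
  ⊥-elim (noCut _
    (sharedNonEdges⇒ΨCut₅ Ψ G (≢-sym u≢v) (≢-sym x≢y) (≢-sym x≢u) (adj-sym G uv) (adj-sym G xy)))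
... | no _     | no _     | yes refl | yes refl = inj₂ (refl , refl)
... | no _     | no _     | yes refl | no y≢u   =
  ⊥-elim (noCut _ (sharedNonEdges⇒ΨCut₅ Ψ G (≢-sym u≢v) x≢y (≢-sym y≢u) (adj-sym G uv) xy))
... | no _     | no _     | no x≢v   | yes refl =
  ⊥-elim (noCut _ (sharedNonEdges⇒ΨCut₅ Ψ G u≢v (≢-sym x≢y) (≢-sym x≢v) uv (adj-sym G xy)))
... | no x≢u   | no y≢v   | no x≢v   | no y≢u   =
  ⊥-elim (noCut _ (disjointNonEdges⇒ΨCut₅ Ψ G u≢v x≢y x≢u x≢v y≢u y≢v uv xy))

-- `e G` is `edgeCount (adj G)` by definition.
edgeCount : (Fin n → Fin n → Bool) → ℕ
edgeCount {n} r = sum (map (λ i → sum (map (λ j →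
                    if (r i j ∧ (toℕ i <ᵇ toℕ j)) then 1 else 0) (allFin n))) (allFin n))

sum-map-mono : ∀ {A : Set} {f g : A → ℕ} (xs : List A) → (∀ x → f x ≤ g x) →
               sum (map f xs) ≤ sum (map g xs)
sum-map-mono []       f≤g = z≤n
sum-map-mono (x ∷ xs) f≤g = +-mono-≤ (f≤g x) (sum-map-mono xs f≤g)

edgeCount-mono : {r s : Fin n → Fin n → Bool} → (∀ i j → r i j ≡ true → s i j ≡ true) →
                 edgeCount r ≤ edgeCount s
edgeCount-mono {n} {r} {s} r⊆s =
  sum-map-mono (allFin n) λ i → sum-map-mono (allFin n) λ j → indicator-mono (r⊆s i j)
  where
  indicator-mono : ∀ {a b c} → (a ≡ true → b ≡ true) →
                   (if (a ∧ c) then 1 else 0) ≤ (if (b ∧ c) then 1 else 0)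
  indicator-mono {false} _   = z≤n
  indicator-mono {true}  a⇒b rewrite a⇒b refl = ≤-refl

-- For u ≡ v this is the complete graph.
completeMinus : Fin n → Fin n → Fin n → Fin n → Bool
completeMinus u v i j = ⌊ ¬? (i ≟ j ⊎-dec (i ≟ u ×-dec j ≟ v) ⊎-dec (i ≟ v ×-dec j ≟ u)) ⌋

completeMinus-true : ∀ {u v i j : Fin n} → completeMinus u v i j ≡ true →
                     ¬ (i ≡ j ⊎ (i ≡ u × j ≡ v) ⊎ (i ≡ v × j ≡ u))
completeMinus-true = toWitness ∘ Equivalence.from T-≡

edgeCount-completeMinus₅ : ∀ (u v : Fin 5) → 9 ≤ edgeCount (completeMinus u v)
edgeCount-completeMinus₅ =
  toWitness {a? = all? λ u → all? λ v → 9 ≤? edgeCount (completeMinus u v)} _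

edgeCount-complete₄ : 6 ≤ edgeCount (completeMinus {4} zero zero)
edgeCount-complete₄ = toWitness {a? = 6 ≤? edgeCount (completeMinus {4} zero zero)} _

nonEdgesWithin⇒completeMinus⊆ : (G : Graph n) {u v : Fin n} →
                                (∀ {i j} → i ≢ j → adj G i j ≡ false →
                                           (i ≡ u × j ≡ v) ⊎ (i ≡ v × j ≡ u)) →
                                ∀ i j → completeMinus u v i j ≡ true → adj G i j ≡ true
nonEdgesWithin⇒completeMinus⊆ G nonEdges i j ij with adj G i j in adj-ij
... | true  = refl
... | false = ⊥-elim (completeMinus-true ij (inj₂ (nonEdges i≢j adj-ij)))
  where i≢j = completeMinus-true ij ∘ inj₁

noΨCut⇒6≤e : (Ψ : Class) (G : Graph 4) → (∀ M → ¬ ΨCut Ψ G M) → 6 ≤ e G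
noΨCut⇒6≤e Ψ G noCut =
  ≤-trans edgeCount-complete₄ (edgeCount-mono (nonEdgesWithin⇒completeMinus⊆ G {zero} {zero}
    λ i≢j ij → ⊥-elim (≡true⇒≢false (noΨCut⇒complete₄ Ψ G noCut i≢j) ij)))

noΨCut⇒9≤e : (Ψ : Class) (G : Graph 5) → (∀ M → ¬ ΨCut Ψ G M) → 9 ≤ e G
noΨCut⇒9≤e Ψ G noCut with any? (λ u → any? (λ v → ¬? (u ≟ v) ×-dec adj G u v Bool.≟ false))
... | yes (u , v , u≢v , uv) =
  ≤-trans (edgeCount-completeMinus₅ u v)
          (edgeCount-mono (nonEdgesWithin⇒completeMinus⊆ G {u} {v}
            (noΨCut⇒uniqueNonEdge₅ Ψ G noCut u≢v uv)))
... | no noNonEdge =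
  ≤-trans (edgeCount-completeMinus₅ zero zero)
          (edgeCount-mono (nonEdgesWithin⇒completeMinus⊆ G {zero} {zero}
            λ {i} {j} i≢j ij → ⊥-elim (noNonEdge (i , j , i≢j , ij))))

ℕ→ℚ-cancel-< : ∀ {m k} → ℕ→ℚ m ℚ.< ℕ→ℚ k → m < k
ℕ→ℚ-cancel-< {m} {k} m<k
  rewrite normalize-coprime (coprime-sym (1-coprimeTo m))
        | normalize-coprime (coprime-sym (1-coprimeTo k))
  with drop-*<* m<k
... | m*1<k*1 rewrite ℤ.*-identityʳ (+ m) | ℤ.*-identityʳ (+ k) = ℤ.drop‿+<+ m*1<k*1

q-pos⇒e< : (α β : ℚ) (G : Graph n) → 0ℚ ℚ.< q α β G → ℕ→ℚ (e G) ℚ.< α * ℕ→ℚ n - β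
q-pos⇒e< {n} α β G q>0 =
  subst₂ ℚ._<_ (+-identityˡ E) (rearrange (α * ℕ→ℚ n) β E) (+-monoˡ-< E q>0)
  where
  E = ℕ→ℚ (e G)
  rearrange : ∀ x β E → ((x - E) - β) + E ≡ x - β
  rearrange = solve 3 (λ x β E → ((x :- E) :- β) :+ E := x :- β) refl

q-pos⇒e<6 : (α β : ℚ) (G : Graph 4) → (+ 4 / 1) * α - β ≡ + 6 / 1 → 0ℚ ℚ.< q α β G → e G < 6
q-pos⇒e<6 α β G 4α-β≡6 q>0 =
  ℕ→ℚ-cancel-<
    (subst₂ ℚ._<_ refl (trans (cong (_- β) (*-comm α (ℕ→ℚ 4))) 4α-β≡6) (q-pos⇒e< α β G q>0))

q-pos⇒e<9 : (α β : ℚ) (G : Graph 5) → α ℚ.≤ + 3 / 1 → (+ 4 / 1) * α - β ≡ + 6 / 1 →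
            0ℚ ℚ.< q α β G → e G < 9
q-pos⇒e<9 α β G α≤3 4α-β≡6 q>0 =
  ℕ→ℚ-cancel-< (<-≤-trans
    (subst₂ ℚ._<_ refl (trans (split α β) (cong (λ x → α + x) 4α-β≡6)) (q-pos⇒e< α β G q>0))
    (+-monoˡ-≤ (+ 6 / 1) α≤3))
  where
  split : ∀ α β → α * ℕ→ℚ 5 - β ≡ α + ((+ 4 / 1) * α - β)
  split = solve 2 (λ α β → α :* con (+ 5 / 1) :- β := α :+ (con (+ 4 / 1) :* α :- β)) refl

lemma5 : (Ψ : Class) (α β : ℚ) →
         (+ 2 / 1) Data.Rational.< α → α Data.Rational.≤ (+ 3 / 1) →
         (+ 4 / 1) * α - β ≡ (+ 6 / 1) →
         ∀ {n} (G : Graph n) → InClassG Ψ α β G → 6 Data.Nat.≤ n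
lemma5 Ψ α β _ α≤3 4α-β≡6 {4} G ((_ , q>0 , noCut) , _) =
  ⊥-elim (<⇒≱ (q-pos⇒e<6 α β G 4α-β≡6 q>0) (noΨCut⇒6≤e Ψ G noCut))
lemma5 Ψ α β _ α≤3 4α-β≡6 {5} G ((_ , q>0 , noCut) , _) =
  ⊥-elim (<⇒≱ (q-pos⇒e<9 α β G α≤3 4α-β≡6 q>0) (noΨCut⇒9≤e Ψ G noCut))
lemma5 _ _ _ _ _ _ {suc (suc (suc (suc (suc (suc n)))))} _ _ = m≤m+n 6 n
lemma5 _ _ _ _ _ _ {0} _ ((()                      , _) , _)
lemma5 _ _ _ _ _ _ {1} _ ((s≤s ()                  , _) , _)
lemma5 _ _ _ _ _ _ {2} _ ((s≤s (s≤s ())            , _) , _)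
lemma5 _ _ _ _ _ _ {3} _ ((s≤s (s≤s (s≤s ()))      , _) , _)
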